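{- Let $M\in\mathcal M$ and $r\in\{\beta,\beta\eta,h\}$. (1) If $M\rhd^*_\eta N$ then $\mathrm{fv}(N)=\mathrm{fv}(M)$ and $d(M)=d(N)$. (2) If $M\rhd^*_rN$ then $\mathrm{fv}(N)\subseteq\mathrm{fv}(M)$ and $d(M)=d(N)$.
   Context: Indexes: finite sequences of natural numbers ($\mathcal L_{\mathbb N}$), $\oslash$ empty, $i::L$ prepending $i$, $L_1\preceq L_2$ (also $L_2\succeq L_1$) iff $L_2=L_1::L_3$ for some $L_3$ (concatenation). Terms: over a countably infinite set $\mathcal V$ of variables, terms $\mathcal M$, free indexed variables $\mathrm{fv}$, degree $d$, joinability $\diamond$ are defined simultaneously: $x^L\in\mathcal M$ ($\mathrm{fv}=\{x^L\}$, $d=L$); $MN\in\mathcal M$ when $d(M)\preceq d(N)$ and $M\diamond N$ ($\mathrm{fv}(MN)=\mathrm{fv}(M)\cup\mathrm{fv}(N)$, $d(MN)=d(M)$); $\lambda x^L.M\in\mathcal M$ when $L\succeq d(M)$ ($\mathrm{fv}=\mathrm{fv}(M)\setminus\{x^L\}$, $d=d(M)$). $M\diamond N$ iff whenever $x^L\in\mathrm{fv}(M)$, $x^K\in\mathrm{fv}(N)$ then $L=K$. Terms modulo $\alpha$-conversion; capture-avoiding substitution $M[x^L:=N]$ defined only if $M\diamond N$ and $d(N)=L$. $\rhd_\beta$: least relation compatible with abstraction and application (when results are terms) containing $(\lambda x^L.M)N\rhd_\beta M[x^L:=N]$ when $d(N)=L$; $\rhd_\eta$: likewise from $\lambda x^L.(Mx^L)\rhd_\eta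 M$ when $x^L\notin\mathrm{fv}(M)$; $\rhd_{\beta\eta}=\rhd_\beta\cup\rhd_\eta$; weak head reduction $(\lambda x^L.M)NN_1\dots N_n\rhd_h M[x^L:=N]N_1\dots N_n$ ($n\ge0$); $\rhd^*_r$ reflexive–transitive closure. -}

module Defs where

open import Data.Nat using (ℕ; zero; suc; _≟_)
open import Data.List using (List; []; _∷_; _++_)
open import Data.Product using (Σ; ∃; _×_; _,_)
open import Data.Sum using (_⊎_)
open import Data.Empty using (⊥)
open import Relation.Nullary using (¬_; yes; no)
open import Relation.Binary.PropositionalEquality using (_≡_)

Index : Set
Index = List ℕ

_⪯_ : Index → Index → Set
L₁ ⪯ L₂ = ∃ λ L₃ → L₂ ≡ L₁ ++ L₃

_⪰_ : Index → Index → Set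
L₂ ⪰ L₁ = L₁ ⪯ L₂

-- Terms modulo α-conversion are represented in locally nameless style:
-- free indexed variables x^L are  fvar x L , bound variables are
-- de Bruijn indices  bvar i , and  lam L M  is  λx^L.M  (the body M
-- refers to the bound variable x^L by  bvar 0).

Var : Set
Var = ℕ

data Tm : Set where
  fvar : Var → Index → Tm
  bvar : ℕ → Tm
  app  : Tm → Tm → Tm
  lam  : Index → Tm → Tm

openAt : ℕ → Tm → Tm → Tm
openAt k u (fvar x L) = fvar x L
openAt k u (bvar i) with i ≟ k
... | yes _ = u
... | no  _ = bvar i
openAt k u (app M N) = app (openAt k u M) (openAt k u N)
openAt k u (lam L M) = lam L (openAt (suc k) u M)

-- M ^ u : the body M of an abstraction instantiated with u
-- (for u = N this is the capture-avoiding substitution M[x^L := N]).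
_^_ : Tm → Tm → Tm
M ^ u = openAt 0 u M

data _∈fv_ : Var × Index → Tm → Set where
  here : ∀ {x L} → (x , L) ∈fv fvar x L
  appˡ : ∀ {v M N} → v ∈fv M → v ∈fv app M N
  appʳ : ∀ {v M N} → v ∈fv N → v ∈fv app M N
  lamᵇ : ∀ {v L M} → v ∈fv M → v ∈fv lam L M

Fresh : Var → Tm → Set
Fresh x M = ∀ K → ¬ ((x , K) ∈fv M)

-- Degree.  dAt Γ M computes the degree where Γ lists the indices of
-- the enclosing binders (bvar i has the index of the i-th binder).

lookupD : List Index → ℕ → Index
lookupD []      _       = []
lookupD (L ∷ Γ) zero    = L
lookupD (L ∷ Γ) (suc i) = lookupD Γ i

dAt : List Index → Tm → Index
dAt Γ (fvar x L) = L
dAt Γ (bvar i)   = lookupD Γ i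
dAt Γ (app M N)  = dAt Γ M
dAt Γ (lam L M)  = dAt (L ∷ Γ) M

d : Tm → Index
d = dAt []

_⋄_ : Tm → Tm → Set
M ⋄ N = ∀ x L K → (x , L) ∈fv M → (x , K) ∈fv N → L ≡ K

data Term : Tm → Set where
  var : ∀ x L → Term (fvar x L)
  app : ∀ {M N} → Term M → Term N → d M ⪯ d N → M ⋄ N → Term (app M N)
  lam : ∀ {L M} (x : Var) → Fresh x M →
        Term (M ^ fvar x L) → L ⪰ d (M ^ fvar x L) → Term (lam L M)

data _▷β_ : Tm → Tm → Set where
  beta : ∀ {L M N} → Term (app (lam L M) N) → d N ≡ L → Term (M ^ N) →
         app (lam L M) N ▷β (M ^ N)
  appˡ : ∀ {M M' N} → Term (app M N) → Term (app M' N) →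
         M ▷β M' → app M N ▷β app M' N
  appʳ : ∀ {M N N'} → Term (app M N) → Term (app M N') →
         N ▷β N' → app M N ▷β app M N'
  lam  : ∀ {L M M'} (x : Var) → Fresh x M → Fresh x M' →
         Term (lam L M) → Term (lam L M') →
         (M ^ fvar x L) ▷β (M' ^ fvar x L) → lam L M ▷β lam L M'

-- η-reduction:  λx^L.(M x^L) ▷ M  with x^L ∉ fv(M); in locally nameless
-- form the body is  app M (bvar 0)  with M locally closed (a term).
data _▷η_ : Tm → Tm → Set where
  eta  : ∀ {L M} → Term (lam L (app M (bvar 0))) → Term M →
         lam L (app M (bvar 0)) ▷η M
  appˡ : ∀ {M M' N} → Term (app M N) → Term (app M' N) →
         M ▷η M' → app M N ▷η app M' N
  appʳ : ∀ {M N N'} → Term (app M N) → Term (app M N') →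
         N ▷η N' → app M N ▷η app M N'
  lam  : ∀ {L M M'} (x : Var) → Fresh x M → Fresh x M' →
         Term (lam L M) → Term (lam L M') →
         (M ^ fvar x L) ▷η (M' ^ fvar x L) → lam L M ▷η lam L M'

_▷βη_ : Tm → Tm → Set
M ▷βη N = (M ▷β N) ⊎ (M ▷η N)

-- weak head reduction: (λx^L.M) N N₁ … Nₙ ▷ M[x^L:=N] N₁ … Nₙ
data _▷h_ : Tm → Tm → Set where
  beta : ∀ {L M N} → Term (app (lam L M) N) → d N ≡ L → Term (M ^ N) →
         app (lam L M) N ▷h (M ^ N)
  appˡ : ∀ {M M' N} → Term (app M N) → Term (app M' N) →
         M ▷h M' → app M N ▷h app M' N

data Red : Set where
  β βη h : Red

Step : Red → Tm → Tm → Set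
Step β  = _▷β_
Step βη = _▷βη_
Step h  = _▷h_

module Submission where

-- Write  Shrinks M N  for "fv(N) ⊆ fv(M) and d(M) = d(N)".  This relation
-- is reflexive and transitive, so it holds along a reduction sequence as
-- soon as it holds for every single step.  A single step is a contraction
-- inside a context built from application and abstraction, and Shrinks is
-- a congruence for these constructors (for abstraction via a fresh
-- opening variable), so only the contractions need real work:
--   * β:  fv(M[x:=N]) ⊆ fv(M) ∪ fv(N), and d(M[x^L:=N]) = d(M) because N
--         has degree L, exactly the index of the variable it replaces;
--   * η:  fv(λx^L.Mx^L) = fv(M), and d(λx^L.Mx^L) = d(M).
-- The degree facts rest on two lemmas about the degree function dAt:
-- opening a body corresponds to recording the degree of the inserted
-- term in the binder context, and the degree of a term (a locally closed
-- Tm) does not depend on the binder context at all.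

open import Defs
open import Data.Empty using (⊥-elim)
open import Data.List using (List; []; _∷_)
open import Data.Nat using (ℕ; zero; suc; _≟_)
open import Data.Product using (_×_; _,_)
open import Data.Sum using (_⊎_; inj₁; inj₂)
import Data.Sum as Sum
open import Function using (_∘_; flip)
open import Function.Bundles using (_⇔_; mk⇔)
open import Relation.Binary.Construct.Closure.ReflexiveTransitive using (Star; fold)
open import Relation.Binary.Core using (Rel; _⇒_)
open import Relation.Binary.PropositionalEquality using (_≡_; _≢_; refl; sym; trans; cong; module ≡-Reasoning)
open import Relation.Nullary using (yes; no)

fv-openAt⁻ : ∀ k u M {v} → v ∈fv openAt k u M → v ∈fv M ⊎ v ∈fv u
fv-openAt⁻ k u (fvar x L) p = inj₁ p
fv-openAt⁻ k u (bvar i) p with i ≟ k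
... | yes _ = inj₂ p
... | no  _ = inj₁ p
fv-openAt⁻ k u (app M N) (appˡ p) = Sum.map₁ appˡ (fv-openAt⁻ k u M p)
fv-openAt⁻ k u (app M N) (appʳ p) = Sum.map₁ appʳ (fv-openAt⁻ k u N p)
fv-openAt⁻ k u (lam L M) (lamᵇ p) = Sum.map₁ lamᵇ (fv-openAt⁻ (suc k) u M p)

fv-openAt⁺ : ∀ k u M {v} → v ∈fv M → v ∈fv openAt k u M
fv-openAt⁺ k u (fvar x L) here     = here
fv-openAt⁺ k u (app M N)  (appˡ p) = appˡ (fv-openAt⁺ k u M p)
fv-openAt⁺ k u (app M N)  (appʳ p) = appʳ (fv-openAt⁺ k u N p)
fv-openAt⁺ k u (lam L M)  (lamᵇ p) = lamᵇ (fv-openAt⁺ (suc k) u M p)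

-- The binder context Γ with its k-th entry set to D; missing entries
-- are filled with [], the degree lookupD assigns to unbound indices.
setAt : ℕ → Index → List Index → List Index
setAt zero    D []      = D ∷ []
setAt zero    D (_ ∷ Γ) = D ∷ Γ
setAt (suc k) D []      = [] ∷ setAt k D []
setAt (suc k) D (L ∷ Γ) = L ∷ setAt k D Γ

lookup-setAt-≡ : ∀ k D Γ → lookupD (setAt k D Γ) k ≡ D
lookup-setAt-≡ zero    D []      = refl
lookup-setAt-≡ zero    D (_ ∷ Γ) = refl
lookup-setAt-≡ (suc k) D []      = lookup-setAt-≡ k D []
lookup-setAt-≡ (suc k) D (_ ∷ Γ) = lookup-setAt-≡ k D Γ

lookup-setAt-≢ : ∀ i k D Γ → i ≢ k → lookupD (setAt k D Γ) i ≡ lookupD Γ i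
lookup-setAt-≢ zero    zero    D Γ       i≢k = ⊥-elim (i≢k refl)
lookup-setAt-≢ zero    (suc k) D []      _   = refl
lookup-setAt-≢ zero    (suc k) D (_ ∷ Γ) _   = refl
lookup-setAt-≢ (suc i) zero    D []      _   = refl
lookup-setAt-≢ (suc i) zero    D (_ ∷ Γ) _   = refl
lookup-setAt-≢ (suc i) (suc k) D []      i≢k = lookup-setAt-≢ i k D [] (i≢k ∘ cong suc)
lookup-setAt-≢ (suc i) (suc k) D (_ ∷ Γ) i≢k = lookup-setAt-≢ i k D Γ (i≢k ∘ cong suc)

dAt-openAt : ∀ u D → (∀ Γ → dAt Γ u ≡ D) →
             ∀ k Γ M → dAt Γ (openAt k u M) ≡ dAt (setAt k D Γ) M
dAt-openAt u D du k Γ (fvar x L) = refl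
dAt-openAt u D du k Γ (bvar i) with i ≟ k
... | yes refl = trans (du Γ) (sym (lookup-setAt-≡ k D Γ))
... | no  i≢k  = sym (lookup-setAt-≢ i k D Γ i≢k)
dAt-openAt u D du k Γ (app M N) = dAt-openAt u D du k Γ M
dAt-openAt u D du k Γ (lam L M) = dAt-openAt u D du (suc k) (L ∷ Γ) M

dAt-open-fvar : ∀ x L Γ M → dAt Γ (M ^ fvar x L) ≡ dAt (setAt 0 L Γ) M
dAt-open-fvar x L = dAt-openAt (fvar x L) L (λ _ → refl) 0

dAt-term : ∀ {N} → Term N → ∀ Γ → dAt Γ N ≡ d N
dAt-term (var x L)       Γ = refl
dAt-term (app t _ _ _)   Γ = dAt-term t Γ
dAt-term (lam {L} {M} x _ t _) Γ = begin
  dAt (L ∷ Γ) M          ≡⟨ sym (dAt-open-fvar x L ([] ∷ Γ) M) ⟩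
  dAt ([] ∷ Γ) (M ^ y)   ≡⟨ dAt-term t ([] ∷ Γ) ⟩
  d (M ^ y)              ≡⟨ dAt-open-fvar x L [] M ⟩
  dAt (L ∷ []) M         ∎
  where
  open ≡-Reasoning
  y = fvar x L

Shrinks : Rel Tm _
Shrinks M N = (∀ v → v ∈fv N → v ∈fv M) × (d M ≡ d N)

shrinks-refl : ∀ {M} → Shrinks M M
shrinks-refl = (λ _ p → p) , refl

shrinks-trans : ∀ {M N P} → Shrinks M N → Shrinks N P → Shrinks M P
shrinks-trans (fv₁ , d₁) (fv₂ , d₂) = (λ v → fv₁ v ∘ fv₂ v) , trans d₁ d₂

star-shrinks : ∀ {ℓ} {R : Rel Tm ℓ} → R ⇒ Shrinks → Star R ⇒ Shrinks
star-shrinks step = fold Shrinks (shrinks-trans ∘ step) shrinks-refl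

star-expands : ∀ {ℓ} {R : Rel Tm ℓ} → R ⇒ flip Shrinks → Star R ⇒ flip Shrinks
star-expands step = fold (flip Shrinks) (λ s p → shrinks-trans p (step s)) shrinks-refl

-- Shrinks is a congruence for application (the degree of an application
-- is that of its function part).
shrinks-appˡ : ∀ {M M' N} → Shrinks M M' → Shrinks (app M N) (app M' N)
shrinks-appˡ (fv⊆ , dM) = (λ { v (appˡ p) → appˡ (fv⊆ v p) ; v (appʳ p) → appʳ p }) , dM

shrinks-appʳ : ∀ {M N N'} → Shrinks N N' → Shrinks (app M N) (app M N')
shrinks-appʳ (fv⊆ , _) = (λ { v (appˡ p) → appˡ p ; v (appʳ p) → appʳ (fv⊆ v p) }) , refl

-- For abstractions the bodies are compared after opening with a variable
-- x^L that is fresh for the new body, so x^L cannot be a spurious witness.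
shrinks-lam : ∀ {x L M M'} → Fresh x M' →
              Shrinks (M ^ fvar x L) (M' ^ fvar x L) → Shrinks (lam L M) (lam L M')
shrinks-lam {x} {L} {M} {M'} fresh (fv⊆ , dM) = fv-lam , degree
  where
  fv-lam : ∀ v → v ∈fv lam L M' → v ∈fv lam L M
  fv-lam v (lamᵇ p) with fv-openAt⁻ 0 (fvar x L) M (fv⊆ v (fv-openAt⁺ 0 (fvar x L) M' p))
  ... | inj₁ q    = lamᵇ q
  ... | inj₂ here = ⊥-elim (fresh L p)
  degree : d (lam L M) ≡ d (lam L M')
  degree = trans (sym (dAt-open-fvar x L [] M)) (trans dM (dAt-open-fvar x L [] M'))

-- β-contraction: the argument has the index of the bound variable, so
-- substituting it leaves the degree of the body unchanged.
shrinks-beta : ∀ {L M N} → Term (app (lam L M) N) → d N ≡ L →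
               Shrinks (app (lam L M) N) (M ^ N)
shrinks-beta {L} {M} {N} (app _ tN _ _) refl = fv⊆ , sym degree
  where
  fv⊆ : ∀ v → v ∈fv (M ^ N) → v ∈fv app (lam L M) N
  fv⊆ v p = Sum.[ (λ q → appˡ (lamᵇ q)) , appʳ ] (fv-openAt⁻ 0 N M p)
  degree : d (M ^ N) ≡ dAt (L ∷ []) M
  degree = dAt-openAt N (d N) (dAt-term tN) 0 [] M

shrinks-eta : ∀ {L M} → Term M → Shrinks (lam L (app M (bvar 0))) M
shrinks-eta {L} tM = (λ v p → lamᵇ (appˡ p)) , dAt-term tM (L ∷ [])

expands-eta : ∀ {L M} → Term M → Shrinks M (lam L (app M (bvar 0)))
expands-eta {L} tM = (λ { v (lamᵇ (appˡ p)) → p ; v (lamᵇ (appʳ ())) })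
                   , sym (dAt-term tM (L ∷ []))

-- Every single β-, h- or η-step shrinks, and an η-step run backwards
-- shrinks as well (η-expands, for which the old body must be fresh).
β-shrinks : _▷β_ ⇒ Shrinks
β-shrinks (beta t dN≡L _)       = shrinks-beta t dN≡L
β-shrinks (appˡ _ _ s)          = shrinks-appˡ (β-shrinks s)
β-shrinks (appʳ _ _ s)          = shrinks-appʳ (β-shrinks s)
β-shrinks (lam _ _ fresh _ _ s) = shrinks-lam fresh (β-shrinks s)

h-shrinks : _▷h_ ⇒ Shrinks
h-shrinks (beta t dN≡L _) = shrinks-beta t dN≡L
h-shrinks (appˡ _ _ s)    = shrinks-appˡ (h-shrinks s)

η-shrinks : _▷η_ ⇒ Shrinks
η-shrinks (eta _ tM)            = shrinks-eta tM
η-shrinks (appˡ _ _ s)          = shrinks-appˡ (η-shrinks s)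
η-shrinks (appʳ _ _ s)          = shrinks-appʳ (η-shrinks s)
η-shrinks (lam _ _ fresh _ _ s) = shrinks-lam fresh (η-shrinks s)

η-expands : _▷η_ ⇒ flip Shrinks
η-expands (eta _ tM)            = expands-eta tM
η-expands (appˡ _ _ s)          = shrinks-appˡ (η-expands s)
η-expands (appʳ _ _ s)          = shrinks-appʳ (η-expands s)
η-expands (lam _ fresh _ _ _ s) = shrinks-lam fresh (η-expands s)

step-shrinks : ∀ r → Step r ⇒ Shrinks
step-shrinks β  = β-shrinks
step-shrinks βη = Sum.[ β-shrinks , η-shrinks ]
step-shrinks h  = h-shrinks

theorem1 : (M : Tm) → Term M →
    ((N : Tm) → Star _▷η_ M N →
      ((v : Var × Index) → (v ∈fv N) ⇔ (v ∈fv M)) × (d M ≡ d N))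
    × ((r : Red) (N : Tm) → Star (Step r) M N →
      ((v : Var × Index) → v ∈fv N → v ∈fv M) × (d M ≡ d N))
theorem1 M _ = η-part , (λ r N → star-shrinks (step-shrinks r))
  where
  η-part : (N : Tm) → Star _▷η_ M N →
           ((v : Var × Index) → (v ∈fv N) ⇔ (v ∈fv M)) × (d M ≡ d N)
  η-part N ss =
    let (fv⊆ , dM≡dN) = star-shrinks η-shrinks ss
        (fv⊇ , _)     = star-expands η-expands ss
    in (λ v → mk⇔ (fv⊆ v) (fv⊇ v)) , dM≡dN
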